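{- Let $\mu\ge0$. Every bipartite graph satisfying the $(1,\mu)$-bow metric is $\delta$-hyperbolic for some $\delta\le\frac{3(\mu+1)}{2}+4$.
   Context: Graphs are finite, simple, unweighted, undirected, connected, with shortest-path distance $d$. The interval is $I(u,v)=\{z: d(u,z)+d(z,v)=d(u,v)\}$. A graph satisfies the $(\lambda,\mu)$-bow metric if for all vertices $u,v,w,x$ with $v\in I(u,w)$, $w\in I(v,x)$ and $d(v,w)>\lambda$, one has $d(u,x)\ge d(u,v)+d(v,w)+d(w,x)-\mu$. $G$ is $\delta$-hyperbolic if for any four vertices the two largest of the sums $d(u,v)+d(w,x)$, $d(u,w)+d(v,x)$, $d(u,x)+d(v,w)$ differ by at most $2\delta$. -}

module Defs where

open import Data.Nat using (ℕ; zero; suc; _+_; _*_; _≤_; _<_; _⊔_)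
open import Data.Fin using (Fin)
open import Data.Bool using (Bool)
open import Data.Product using (Σ; ∃; _×_)
open import Relation.Binary.PropositionalEquality using (_≡_; _≢_)
open import Relation.Nullary using (¬_)

record Graph (n : ℕ) : Set₁ where
  field
    _~_   : Fin n → Fin n → Set
    sym   : ∀ {u v} → u ~ v → v ~ u
    irrefl : ∀ {u} → ¬ (u ~ u)
open Graph public

data Walk {n : ℕ} (G : Graph n) : Fin n → Fin n → ℕ → Set where
  nil  : ∀ {u} → Walk G u u 0
  cons : ∀ {u w v k} → _~_ G u w → Walk G w v k → Walk G u v (suc k)

Connected : ∀ {n} → Graph n → Set
Connected G = ∀ u v → ∃ λ k → Walk G u v k

IsDistance : ∀ {n} → Graph n → (Fin n → Fin n → ℕ) → Set
IsDistance G d = ∀ u v → Walk G u v (d u v) × (∀ k → Walk G u v k → d u v ≤ k)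

Bipartite : ∀ {n} → Graph n → Set
Bipartite {n} G = Σ (Fin n → Bool) λ c → ∀ {u v} → _~_ G u v → c u ≢ c v

InInterval : ∀ {n} → (Fin n → Fin n → ℕ) → Fin n → Fin n → Fin n → Set
InInterval d u v z = d u z + d z v ≡ d u v

-- (λ,μ)-bow metric, for natural λ, μ (distances are integers).
-- d(u,x) ≥ d(u,v)+d(v,w)+d(w,x) − μ  written without subtraction.
BowMetric : ∀ {n} → (Fin n → Fin n → ℕ) → ℕ → ℕ → Set
BowMetric d λ' μ = ∀ u v w x → InInterval d u w v → InInterval d v x w → λ' < d v w →
  d u v + d v w + d w x ≤ d u x + μ

-- Four-point condition with 2δ = D: the largest of the three sums exceeds the
-- second largest by at most D; equivalently each sum is ≤ max of the other two + D.
Hyperbolic2 : ∀ {n} → (Fin n → Fin n → ℕ) → ℕ → Set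
Hyperbolic2 d D = ∀ u v w x →
  let S₁ = d u v + d w x
      S₂ = d u w + d v x
      S₃ = d u x + d v w
  in (S₁ ≤ (S₂ ⊔ S₃) + D) × (S₂ ≤ (S₁ ⊔ S₃) + D) × (S₃ ≤ (S₁ ⊔ S₂) + D)

{-# OPTIONS --safe #-}
-- In a bipartite graph the distances from p of two adjacent vertices differ by exactly one.
-- So, walking from x along geodesics towards p and q simultaneously, either some neighbour
-- advances towards both, or we reach a vertex z whose neighbours v (towards p) and w (towards q)
-- are at distance 2 > 1; the bow metric on p, v, w, q then gives d(z,p) + d(z,q) ≤ d(p,q) + μ.
-- Using such a branch point at a point p of a geodesic x–y, a second application of the bow
-- metric shows that points of a geodesic at equal distance from x are (μ+2)-close. Comparing
-- the branch points of (x; p, r) and (x; q, r) along a geodesic x–r then gives the four-point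
-- condition with 2δ = 2(μ+1).
module Submission where

open import Defs hiding (_~_; sym)
open import Data.Bool using (Bool; not)
open import Data.Bool.Properties using (¬-not)
open import Data.Fin using (Fin)
open import Data.Nat using (ℕ; zero; suc; _+_; _*_; _≤_; _⊔_; s≤s)
open import Data.Nat.GeneralisedArithmetic using (iterate)
open import Data.Nat.Properties
open import Data.Nat.Tactic.RingSolver using (solve-∀)
open import Data.Product using (∃; ∃-syntax; _×_; _,_; proj₁; proj₂)
open import Data.Sum using (_⊎_; inj₁; inj₂; [_,_]′)
open import Function using (_∘_)
open import Relation.Binary.Definitions using (tri<; tri≈; tri>)
open import Relation.Binary.PropositionalEquality
open import Relation.Nullary using (yes; no; contradiction)

module _ {n : ℕ} {G : Graph n} where
  open Graph G using () renaming (sym to ~-sym)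

  _++ʷ_ : ∀ {a b c k l} → Walk G a b k → Walk G b c l → Walk G a c (k + l)
  nil      ++ʷ q = q
  cons e p ++ʷ q = cons e (p ++ʷ q)

  reverseʷ : ∀ {a b k} → Walk G a b k → Walk G b a k
  reverseʷ nil                = nil
  reverseʷ (cons {k = k} e p) = subst (Walk G _ _) (+-comm k 1) (reverseʷ p ++ʷ cons (~-sym e) nil)

  splitʷ : ∀ k {a b l} → Walk G a b (k + l) → ∃[ m ] Walk G a m k × Walk G m b l
  splitʷ zero    p          = _ , nil , p
  splitʷ (suc k) (cons e p) = let m , p₁ , p₂ = splitʷ k p in m , cons e p₁ , p₂

four-point⇒Hyperbolic2 : ∀ {n} (d : Fin n → Fin n → ℕ) D → (∀ u v → d u v ≡ d v u) →
  (∀ u v w x → d u v + d w x ≤ (d u w + d v x) ⊔ (d u x + d v w) + D) → Hyperbolic2 d D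
four-point⇒Hyperbolic2 d D d-sym four-point u v w x =
  four-point u v w x ,
  subst (λ t → d u w + d v x ≤ (d u v + d w x) ⊔ (d u x + t) + D) (d-sym w v) (four-point u w v x) ,
  subst₂ (λ s t → d u x + d v w ≤ (d u v + s) ⊔ (d u w + t) + D) (d-sym x w) (d-sym x v)
    (four-point u x v w)

module Metric {n : ℕ} {G : Graph n} {d : Fin n → Fin n → ℕ} (isDistance : IsDistance G d) where
  open Graph G using (_~_)
  open ≤-Reasoning

  I : Fin n → Fin n → Fin n → Set
  I = InInterval d

  geodesic : ∀ u v → Walk G u v (d u v)
  geodesic u v = proj₁ (isDistance u v)

  d-≤-walk : ∀ {u v k} → Walk G u v k → d u v ≤ k
  d-≤-walk {u} {v} {k} = proj₂ (isDistance u v) k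

  d-refl : ∀ u → d u u ≡ 0
  d-refl u = n≤0⇒n≡0 (d-≤-walk nil)

  d-sym : ∀ u v → d u v ≡ d v u
  d-sym u v = ≤-antisym (d-≤-walk (reverseʷ (geodesic v u))) (d-≤-walk (reverseʷ (geodesic u v)))

  d-triangle : ∀ u v w → d u w ≤ d u v + d v w
  d-triangle u v w = d-≤-walk (geodesic u v ++ʷ geodesic v w)

  d-edge : ∀ {u v} → u ~ v → d u v ≤ 1
  d-edge e = d-≤-walk (cons e nil)

  d-neighbour : ∀ {u w} p → u ~ w → d u p ≤ suc (d w p)
  d-neighbour {u} {w} p e = ≤-trans (d-triangle u w p) (+-monoˡ-≤ (d w p) (d-edge e))

  arrived-or-step : ∀ u v → d u v ≡ 0 ⊎ ∃[ w ] u ~ w × suc (d w v) ≡ d u v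
  arrived-or-step u v = first-step (geodesic u v) refl
    where
    first-step : ∀ {b k} → Walk G u b k → k ≡ d u b →
      d u b ≡ 0 ⊎ ∃[ w ] u ~ w × suc (d w b) ≡ d u b
    first-step nil                    k≡dub = inj₁ (sym k≡dub)
    first-step {b} (cons {w = w} e p) k≡dub =
      inj₂ (w , e , ≤-antisym (subst (suc (d w b) ≤_) k≡dub (s≤s (d-≤-walk p))) (d-neighbour b e))

  geodesic-step : ∀ {u v k} → d u v ≡ suc k → ∃[ w ] u ~ w × suc (d w v) ≡ d u v
  geodesic-step {u} {v} duv≡1+k with arrived-or-step u v
  ... | inj₁ duv≡0 = contradiction (trans (sym duv≡0) duv≡1+k) 0≢1+n
  ... | inj₂ step  = step

  I-intro : ∀ {x y z} → d x z + d z y ≤ d x y → I x y z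
  I-intro {x} {y} {z} le = ≤-antisym le (d-triangle x z y)

  I-start : ∀ x y → I x y x
  I-start x y = cong (_+ d x y) (d-refl x)

  I-sym : ∀ {x y z} → I x y z → I y x z
  I-sym {x} {y} {z} z∈I = begin-equality
    d y z + d z x ≡⟨ cong₂ _+_ (d-sym y z) (d-sym z x) ⟩
    d z y + d x z ≡⟨ +-comm (d z y) (d x z) ⟩
    d x z + d z y ≡⟨ z∈I ⟩
    d x y         ≡⟨ d-sym x y ⟩
    d y x         ∎

  ∈I-suffix : ∀ {x y z w} → I x y z → I z y w → I x y w
  ∈I-suffix {x} {y} {z} {w} z∈I w∈I = I-intro (begin
    d x w + d w y           ≤⟨ +-monoˡ-≤ (d w y) (d-triangle x z w) ⟩
    d x z + d z w + d w y   ≡⟨ +-assoc (d x z) (d z w) (d w y) ⟩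
    d x z + (d z w + d w y) ≡⟨ cong (d x z +_) w∈I ⟩
    d x z + d z y           ≡⟨ z∈I ⟩
    d x y                   ∎)

  ∈I-prefix : ∀ {x y z w} → I x y z → I x z w → I x y w
  ∈I-prefix {x} {y} {z} {w} z∈I w∈I = I-intro (begin
    d x w + d w y           ≤⟨ +-monoʳ-≤ (d x w) (d-triangle w z y) ⟩
    d x w + (d w z + d z y) ≡⟨ sym (+-assoc (d x w) (d w z) (d z y)) ⟩
    d x w + d w z + d z y   ≡⟨ cong (_+ d z y) w∈I ⟩
    d x z + d z y           ≡⟨ z∈I ⟩
    d x y                   ∎)

  ∈I-glue : ∀ {x y z w} → I x y z → I z y w → I x w z
  ∈I-glue {x} {y} {z} {w} z∈I w∈I = I-intro (+-cancelʳ-≤ (d w y) (d x z + d z w) (d x w) (begin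
    d x z + d z w + d w y   ≡⟨ +-assoc (d x z) (d z w) (d w y) ⟩
    d x z + (d z w + d w y) ≡⟨ cong (d x z +_) w∈I ⟩
    d x z + d z y           ≡⟨ z∈I ⟩
    d x y                   ≤⟨ d-triangle x w y ⟩
    d x w + d w y           ∎))

  edge-∈I : ∀ {z w y} → z ~ w → suc (d w y) ≡ d z y → I z y w
  edge-∈I {z} {w} {y} e eq = I-intro (≤-trans (+-monoˡ-≤ (d w y) (d-edge e)) (≤-reflexive eq))

  point-on-geodesic : ∀ {a b k} → k ≤ d a b → ∃[ m ] d a m ≡ k × I a b m
  point-on-geodesic {a} {b} {k} k≤dab with m≤n⇒∃[o]m+o≡n k≤dab
  ... | l , k+l≡dab with splitʷ k (subst (Walk G a b) (sym k+l≡dab) (geodesic a b))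
  ... | m , p₁ , p₂ = m , ≤-antisym (d-≤-walk p₁) k≤dam , m∈I
    where
    m∈I : I a b m
    m∈I = I-intro (≤-trans (+-mono-≤ (d-≤-walk p₁) (d-≤-walk p₂)) (≤-reflexive k+l≡dab))
    k≤dam : k ≤ d a m
    k≤dam = +-cancelʳ-≤ l k (d a m) (begin
      k + l         ≡⟨ k+l≡dab ⟩
      d a b         ≡⟨ sym m∈I ⟩
      d a m + d m b ≤⟨ +-monoʳ-≤ (d a m) (d-≤-walk p₂) ⟩
      d a m + l     ∎)

module Bipartition {n : ℕ} {G : Graph n} {d : Fin n → Fin n → ℕ} (isDistance : IsDistance G d)
  (c : Fin n → Bool) (proper : ∀ {u v} → Graph._~_ G u v → c u ≢ c v) where
  open Graph G using (_~_) renaming (sym to ~-sym)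
  open Metric isDistance

  walk-colour : ∀ {a b k} → Walk G a b k → c b ≡ iterate not (c a) k
  walk-colour nil = refl
  walk-colour {k = suc k} (cons e p) =
    trans (walk-colour p) (cong (λ b → iterate not b k) (¬-not (proper e ∘ sym)))

  adjacent-distances-differ : ∀ {u w} p → u ~ w → d p u ≢ d p w
  adjacent-distances-differ {u} {w} p e dpu≡dpw = proper e (begin
    c u                       ≡⟨ walk-colour (geodesic p u) ⟩
    iterate not (c p) (d p u) ≡⟨ cong (iterate not (c p)) dpu≡dpw ⟩
    iterate not (c p) (d p w) ≡⟨ sym (walk-colour (geodesic p w)) ⟩
    c w                       ∎)
    where open ≡-Reasoning

  adjacent-distance : ∀ {u w} p → u ~ w → suc (d u p) ≡ d w p ⊎ suc (d w p) ≡ d u p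
  adjacent-distance {u} {w} p e with <-cmp (d u p) (d w p)
  ... | tri< dup<dwp _ _ = inj₁ (≤-antisym dup<dwp (d-neighbour p (~-sym e)))
  ... | tri≈ _ dup≡dwp _ =
    contradiction (trans (d-sym p u) (trans dup≡dwp (d-sym w p))) (adjacent-distances-differ p e)
  ... | tri> _ _ dwp<dup = inj₂ (≤-antisym dwp<dup (d-neighbour p e))

module BowGeometry {n : ℕ} {G : Graph n} {d : Fin n → Fin n → ℕ} (isDistance : IsDistance G d)
  (c : Fin n → Bool) (proper : ∀ {u v} → Graph._~_ G u v → c u ≢ c v)
  {μ : ℕ} (bow : BowMetric d 1 μ) where
  open Graph G using (_~_) renaming (sym to ~-sym)
  open Metric isDistance
  open Bipartition isDistance c proper
  open ≤-Reasoning

  record BranchPoint (x p q : Fin n) : Set where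
    constructor branch
    field
      centre        : Fin n
      centre∈I[x,p] : I x p centre
      centre∈I[x,q] : I x q centre
      detour        : d centre p + d centre q ≤ d p q + μ

  open BranchPoint using (centre)

  detour-at-endpoint : ∀ {z p q} → d z p ≡ 0 → d z p + d z q ≤ d p q + μ
  detour-at-endpoint {z} {p} {q} dzp≡0 = begin
    d z p + d z q ≡⟨ cong (_+ d z q) dzp≡0 ⟩
    d z q         ≤⟨ d-triangle z p q ⟩
    d z p + d p q ≡⟨ cong (_+ d p q) dzp≡0 ⟩
    d p q         ≤⟨ m≤m+n (d p q) μ ⟩
    d p q + μ     ∎

  detour-swap : ∀ {z p q} → d z q + d z p ≤ d q p + μ → d z p + d z q ≤ d p q + μ
  detour-swap {z} {p} {q} le = subst₂ (λ s t → s ≤ t + μ) (+-comm (d z q) (d z p)) (d-sym q p) le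

  detour-by-bow : ∀ {z v w p q} → z ~ v → z ~ w →
    suc (d v p) ≡ d z p → suc (d w q) ≡ d z q → suc (d z p) ≡ d w p → suc (d z q) ≡ d v q →
    d z p + d z q ≤ d p q + μ
  detour-by-bow {z} {v} {w} {p} {q} z~v z~w vp wq zp zq = begin
    d z p + d z q             ≡⟨ cong₂ _+_ (sym vp) (sym wq) ⟩
    suc (d v p) + suc (d w q) ≡⟨ two-steps (d v p) (d w q) ⟩
    d v p + 2 + d w q         ≡⟨ cong₂ (λ s t → s + t + d w q) (d-sym v p) (sym dvw≡2) ⟩
    d p v + d v w + d w q     ≤⟨ bow p v w q (I-sym v∈I[w,p]) w∈I[v,q] (≤-reflexive (sym dvw≡2)) ⟩
    d p q + μ                 ∎
    where
    two-steps : ∀ a b → suc a + suc b ≡ a + 2 + b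
    two-steps = solve-∀
    v∈I[w,p] : I w p v
    v∈I[w,p] = ∈I-suffix (edge-∈I (~-sym z~w) zp) (edge-∈I z~v vp)
    w∈I[v,q] : I v q w
    w∈I[v,q] = ∈I-suffix (edge-∈I (~-sym z~v) zq) (edge-∈I z~w wq)
    dvw≡2 : d v w ≡ 2
    dvw≡2 = trans (d-sym v w) (+-cancelʳ-≡ (d v p) (d w v) 2
      (trans v∈I[w,p] (trans (sym zp) (cong suc (sym vp)))))

  module _ {x p q : Fin n} where
    branch-from : ∀ k z → d z p ≡ k → I x p z → I x q z → BranchPoint x p q
    advance : ∀ {k z w} → z ~ w → d z p ≡ suc k → suc (d w p) ≡ d z p → suc (d w q) ≡ d z q →
      I x p z → I x q z → BranchPoint x p q

    branch-from zero z dzp≡0 z∈I[x,p] z∈I[x,q] =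
      branch z z∈I[x,p] z∈I[x,q] (detour-at-endpoint dzp≡0)
    branch-from (suc k) z dzp≡1+k z∈I[x,p] z∈I[x,q] with arrived-or-step z q
    ... | inj₁ dzq≡0 = branch z z∈I[x,p] z∈I[x,q] (detour-swap (detour-at-endpoint dzq≡0))
    ... | inj₂ (w , z~w , wq) with geodesic-step dzp≡1+k
    ... | v , z~v , vp with adjacent-distance p z~w | adjacent-distance q z~v
    ... | inj₂ wp | _      = advance z~w dzp≡1+k wp wq z∈I[x,p] z∈I[x,q]
    ... | inj₁ _  | inj₂ vq = advance z~v dzp≡1+k vp vq z∈I[x,p] z∈I[x,q]
    ... | inj₁ zp | inj₁ zq = branch z z∈I[x,p] z∈I[x,q] (detour-by-bow z~v z~w vp wq zp zq)

    advance {k} {z} {w} z~w dzp≡1+k wp wq z∈I[x,p] z∈I[x,q] =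
      branch-from k w (suc-injective (trans wp dzp≡1+k))
        (∈I-suffix z∈I[x,p] (edge-∈I z~w wp)) (∈I-suffix z∈I[x,q] (edge-∈I z~w wq))

  branch-point : ∀ x p q → BranchPoint x p q
  branch-point x p q = branch-from (d x p) x refl (I-start x p) (I-start x q)

  equidistant-close : ∀ {x y p q} → I x y p → I x y q → d x p ≡ d x q → d p q ≤ μ + 2
  equidistant-close {x} {y} {p} {q} p∈I[x,y] q∈I[x,y] dxp≡dxq with branch-point p y q
  ... | branch m m∈I[p,y] m∈I[p,q] detour with 1 <? d p m
  ... | yes 1<dpm = ≤-trans dpq≤μ (m≤m+n μ 2)
    where
    bow-xpmq : d x p + d p m + d m q ≤ d x q + μ
    bow-xpmq = bow x p m q (∈I-glue p∈I[x,y] m∈I[p,y]) m∈I[p,q] 1<dpm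
    dpq≤μ : d p q ≤ μ
    dpq≤μ = +-cancelˡ-≤ (d x p) (d p q) μ (begin
      d x p + d p q           ≡⟨ cong (d x p +_) (sym m∈I[p,q]) ⟩
      d x p + (d p m + d m q) ≡⟨ sym (+-assoc (d x p) (d p m) (d m q)) ⟩
      d x p + d p m + d m q   ≤⟨ bow-xpmq ⟩
      d x q + μ               ≡⟨ cong (_+ μ) (sym dxp≡dxq) ⟩
      d x p + μ               ∎)
  ... | no 1≮dpm = begin
      d p q                   ≡⟨ sym m∈I[p,q] ⟩
      d p m + d m q           ≤⟨ +-monoʳ-≤ (d p m) dmq≤dpm+μ ⟩
      d p m + (d p m + μ)     ≤⟨ +-mono-≤ dpm≤1 (+-monoˡ-≤ μ dpm≤1) ⟩
      1 + (1 + μ)             ≡⟨ +-comm 2 μ ⟩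
      μ + 2                   ∎
    where
    dpm≤1 : d p m ≤ 1
    dpm≤1 = ≮⇒≥ 1≮dpm
    dpy≡dqy : d p y ≡ d q y
    dpy≡dqy = +-cancelˡ-≡ (d x p) (d p y) (d q y)
      (trans p∈I[x,y] (trans (sym q∈I[x,y]) (cong (_+ d q y) (sym dxp≡dxq))))
    dmq≤dpm+μ : d m q ≤ d p m + μ
    dmq≤dpm+μ = +-cancelˡ-≤ (d m y) (d m q) (d p m + μ) (begin
      d m y + d m q           ≤⟨ detour ⟩
      d y q + μ               ≡⟨ cong (_+ μ) (trans (d-sym y q) (sym dpy≡dqy)) ⟩
      d p y + μ               ≡⟨ cong (_+ μ) (sym m∈I[p,y]) ⟩
      d p m + d m y + μ       ≡⟨ swap (d p m) (d m y) μ ⟩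
      d m y + (d p m + μ)     ∎)
      where
      swap : ∀ a b k → a + b + k ≡ b + (a + k)
      swap = solve-∀

  four-point-via-branch : ∀ {x p q r} (b₁ : BranchPoint x p r) (b₂ : BranchPoint x q r) →
    d x (centre b₁) ≤ d x (centre b₂) → d p q + d x r ≤ d x q + d p r + 2 * (μ + 1)
  four-point-via-branch {x} {p} {q} {r}
    (branch z₁ z₁∈I[x,p] z₁∈I[x,r] detour) (branch z₂ z₂∈I[x,q] z₂∈I[x,r] _) dxz₁≤dxz₂
    with point-on-geodesic dxz₁≤dxz₂
  ... | z′ , dxz′≡dxz₁ , z′∈I[x,z₂] = begin
      d p q + d x r                                  ≤⟨ +-mono-≤ path (≤-reflexive (sym z₁∈I[x,r])) ⟩
      d z₁ p + (d z₁ z′ + d z′ q) + (d x z₁ + d z₁ r) ≤⟨ +-monoˡ-≤ (d x z₁ + d z₁ r)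
                                                          (+-monoʳ-≤ (d z₁ p) (+-monoˡ-≤ (d z′ q) close)) ⟩
      d z₁ p + (μ + 2 + d z′ q) + (d x z₁ + d z₁ r)   ≡⟨ regroup (d z₁ p) (d z′ q) (d x z₁) (d z₁ r) (μ + 2) ⟩
      d z₁ p + d z₁ r + (d x z₁ + d z′ q) + (μ + 2)   ≤⟨ +-monoˡ-≤ (μ + 2) (+-mono-≤ detour (≤-reflexive dxq)) ⟩
      d p r + μ + d x q + (μ + 2)                    ≡⟨ collect (d p r) (d x q) μ ⟩
      d x q + d p r + 2 * (μ + 1)                    ∎
    where
    regroup : ∀ a b s t k → a + (k + b) + (s + t) ≡ a + t + (s + b) + k
    regroup = solve-∀
    collect : ∀ a b k → a + k + b + (k + 2) ≡ b + a + 2 * (k + 1)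
    collect = solve-∀
    z′∈I[x,q] : I x q z′
    z′∈I[x,q] = ∈I-prefix z₂∈I[x,q] z′∈I[x,z₂]
    close : d z₁ z′ ≤ μ + 2
    close = equidistant-close z₁∈I[x,r] (∈I-prefix z₂∈I[x,r] z′∈I[x,z₂]) (sym dxz′≡dxz₁)
    path : d p q ≤ d z₁ p + (d z₁ z′ + d z′ q)
    path = ≤-trans (d-triangle p z₁ q) (+-mono-≤ (≤-reflexive (d-sym p z₁)) (d-triangle z₁ z′ q))
    dxq : d x z₁ + d z′ q ≡ d x q
    dxq = trans (cong (_+ d z′ q) (sym dxz′≡dxz₁)) z′∈I[x,q]

  four-point : ∀ u v w x → d u v + d w x ≤ (d u w + d v x) ⊔ (d u x + d v w) + 2 * (μ + 1)
  four-point u v w x = [ via-u , via-v ]′ (≤-total (d w (centre bᵤ)) (d w (centre bᵥ)))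
    where
    bᵤ : BranchPoint w u x
    bᵤ = branch-point w u x
    bᵥ : BranchPoint w v x
    bᵥ = branch-point w v x
    D : ℕ
    D = 2 * (μ + 1)
    via-u : d w (centre bᵤ) ≤ d w (centre bᵥ) → d u v + d w x ≤ (d u w + d v x) ⊔ (d u x + d v w) + D
    via-u le = begin
      d u v + d w x           ≤⟨ four-point-via-branch bᵤ bᵥ le ⟩
      d w v + d u x + D       ≡⟨ cong (_+ D) (trans (+-comm (d w v) (d u x)) (cong (d u x +_) (d-sym w v))) ⟩
      d u x + d v w + D       ≤⟨ +-monoˡ-≤ D (m≤n⊔m (d u w + d v x) (d u x + d v w)) ⟩
      (d u w + d v x) ⊔ (d u x + d v w) + D ∎
    via-v : d w (centre bᵥ) ≤ d w (centre bᵤ) → d u v + d w x ≤ (d u w + d v x) ⊔ (d u x + d v w) + D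
    via-v le = begin
      d u v + d w x           ≡⟨ cong (_+ d w x) (d-sym u v) ⟩
      d v u + d w x           ≤⟨ four-point-via-branch bᵥ bᵤ le ⟩
      d w u + d v x + D       ≡⟨ cong (λ t → t + d v x + D) (d-sym w u) ⟩
      d u w + d v x + D       ≤⟨ +-monoˡ-≤ D (m≤m⊔n (d u w + d v x) (d u x + d v w)) ⟩
      (d u w + d v x) ⊔ (d u x + d v w) + D ∎

  hyperbolic : Hyperbolic2 d (2 * (μ + 1))
  hyperbolic = four-point⇒Hyperbolic2 d (2 * (μ + 1)) d-sym four-point

corollary10 : ∀ (μ : ℕ) {n : ℕ} (G : Graph n) (d : Fin n → Fin n → ℕ) →
    Connected G → IsDistance G d → Bipartite G → BowMetric d 1 μ →
    ∃ λ D → (D ≤ 3 * (μ + 1) + 8) × Hyperbolic2 d D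
corollary10 μ G d _ isDistance (colour , proper) bow =
  2 * (μ + 1) , 2[μ+1]≤3[μ+1]+8 , BowGeometry.hyperbolic isDistance colour proper bow
  where
  2[μ+1]≤3[μ+1]+8 : 2 * (μ + 1) ≤ 3 * (μ + 1) + 8
  2[μ+1]≤3[μ+1]+8 = ≤-trans (*-monoˡ-≤ (μ + 1) (n≤1+n 2)) (m≤m+n (3 * (μ + 1)) 8)
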